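{- Let $H=(V,E)$ be a hypergraph and let $V_1,V_2\subseteq V$ with $V_1\cap V_2\neq\emptyset$ be such that the induced subhypergraphs of $H$ on $V_1$ and on $V_2$ are strongly connected. Then the induced subhypergraph of $H$ on $V_1\cup V_2$ is strongly connected.
   Context: Edges of $H$ are nonempty subsets of $V$. The induced subhypergraph on $V'\subseteq V$ is $(V',E')$ with $E'=\{e\in E: e\subseteq V'\}$. A subset $C$ of edges is a cycle if $|C|=|\bigcup_{e\in C}e|$ and no proper nonempty subset of $C$ has this property; a spanning forest is a set of edges containing no cycle; a spanning tree of a hypergraph on vertex set $W$ is a spanning forest with $|W|-1$ edges; a hypergraph is strongly connected if it has a spanning tree. -}

module Defs where

open import Data.Nat using (ℕ; _+_)
open import Data.Bool using (if_then_else_)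
open import Data.Fin using (Fin)
open import Data.Fin.Subset using (Subset; _∈_; _⊆_; _⊂_; ⋃; ∣_∣; Nonempty)
import Data.Fin.Subset as S
open import Data.Vec using (lookup)
open import Data.List using (map; allFin)
open import Data.Product using (∃; _×_)
open import Relation.Binary.PropositionalEquality using (_≡_; _≢_)
open import Relation.Nullary using (¬_)
open import Function.Definitions using (Injective)

-- A finite hypergraph on vertex set Fin n; its edge set E is given as an
-- injective family (so E is a set) of nonempty vertex subsets indexed by Fin m.
record Hypergraph (n : ℕ) : Set where
  field
    m        : ℕ
    edge     : Fin m → Subset n
    nonempty : ∀ i → Nonempty (edge i)
    distinct : Injective _≡_ _≡_ edge

module _ {n : ℕ} (H : Hypergraph n) where
  open Hypergraph H

  EdgeSet : Set
  EdgeSet = Subset m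

  edgeUnion : EdgeSet → Subset n
  edgeUnion C = ⋃ (map (λ i → if lookup C i then edge i else S.⊥) (allFin m))

  Balanced : EdgeSet → Set
  Balanced C = ∣ C ∣ ≡ ∣ edgeUnion C ∣

  IsCycle : EdgeSet → Set
  IsCycle C = Nonempty C × Balanced C × (∀ D → D ⊂ C → Nonempty D → ¬ Balanced D)

  InInduced : Subset n → EdgeSet → Set
  InInduced W F = ∀ {i} → i ∈ F → edge i ⊆ W

  IsSpanningForest : EdgeSet → Set
  IsSpanningForest F = ∀ C → C ⊆ F → ¬ IsCycle C

  IsSpanningTreeOn : Subset n → EdgeSet → Set
  IsSpanningTreeOn W F = InInduced W F × IsSpanningForest F × ∣ F ∣ + 1 ≡ ∣ W ∣

  StronglyConnectedOn : Subset n → Set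
  StronglyConnectedOn W = ∃ λ F → IsSpanningTreeOn W F

module Submission where

-- Write U = V₂ ─ V₁. A set of edges is a spanning forest iff each nonempty subset
-- D of it expands: |D| < |⋃D|. For a spanning tree F₂ on V₂ and Z ⊆ U, the edges
-- of F₂ avoiding Z expand into V₂ ─ Z (if there are none, V₂ ─ Z still contains
-- a vertex of V₁ ∩ V₂), so |F₂| = |V₂| - 1 forces Hall's condition: at least |Z|
-- edges of F₂ meet Z. Hall's theorem yields S ⊆ F₂ with |S| = |U| in which every
-- D ⊆ S has |D| ≤ |⋃D ∩ U|. Adding S to a spanning tree F₁ on V₁ keeps every
-- subset expanding, since the part in S contributes that many vertices of U,
-- outside V₁; and it gives (|V₁| - 1) + |U| = |V₁ ∪ V₂| - 1 edges.

open import Defs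
open import Algebra.Properties.CommutativeSemigroup using ()
open import Data.Bool using (true; false; if_then_else_)
open import Data.Fin using (Fin; _≟_)
open import Data.Fin.Subset
open import Data.Fin.Subset.Properties
open import Data.List using (List; []; _∷_; map; allFin)
open import Data.List.Membership.Propositional using () renaming (_∈_ to _∈ₗ_)
open import Data.List.Membership.Propositional.Properties using (∈-map⁺; ∈-map⁻; ∈-allFin)
open import Data.List.Relation.Unary.Any as Any using ()
open import Data.Nat using (ℕ; suc; _+_; _≤_; _<_; z≤n; _≤?_; _<?_)
open import Data.Nat.Induction using (<-wellFounded)
open import Data.Nat.Properties hiding (_≟_)
open import Data.Product using (∃; _×_; _,_; proj₁; proj₂)
open import Data.Sum using (_⊎_; inj₁; inj₂)
open import Data.Vec using ([]; _∷_; there; lookup; tabulate)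
open import Data.Vec.Properties using (lookup⇒[]=; []=⇒lookup; lookup∘tabulate)
open import Function using (_∘_)
open import Induction.WellFounded using (Acc; acc)
open import Relation.Binary.PropositionalEquality
open import Relation.Nullary using (¬_; yes; no; does; Dec; contradiction)
open import Relation.Nullary.Decidable using (_×-dec_; dec-true)

open Algebra.Properties.CommutativeSemigroup +-commutativeSemigroup using (xy∙z≈xz∙y)

private variable
  n : ℕ
  p q r : Subset n
  x : Fin n

-- Cardinality of finite subsets

x∈p─q⇒x∉q : x ∈ p ─ q → x ∉ q
x∈p─q⇒x∉q {p = _ ∷ p} {inside  ∷ q} (there x∈) (there x∈q) = x∈p─q⇒x∉q x∈ x∈q
x∈p─q⇒x∉q {p = _ ∷ p} {outside ∷ q} (there x∈) (there x∈q) = x∈p─q⇒x∉q x∈ x∈q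

∣p∪q∣+∣p∩q∣≡∣p∣+∣q∣ : ∀ (p q : Subset n) → ∣ p ∪ q ∣ + ∣ p ∩ q ∣ ≡ ∣ p ∣ + ∣ q ∣
∣p∪q∣+∣p∩q∣≡∣p∣+∣q∣ []            []            = refl
∣p∪q∣+∣p∩q∣≡∣p∣+∣q∣ (inside  ∷ p) (inside  ∷ q) =
  cong suc (trans (+-suc ∣ p ∪ q ∣ ∣ p ∩ q ∣)
    (trans (cong suc (∣p∪q∣+∣p∩q∣≡∣p∣+∣q∣ p q)) (sym (+-suc ∣ p ∣ ∣ q ∣))))
∣p∪q∣+∣p∩q∣≡∣p∣+∣q∣ (inside  ∷ p) (outside ∷ q) = cong suc (∣p∪q∣+∣p∩q∣≡∣p∣+∣q∣ p q)
∣p∪q∣+∣p∩q∣≡∣p∣+∣q∣ (outside ∷ p) (inside  ∷ q) =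
  trans (cong suc (∣p∪q∣+∣p∩q∣≡∣p∣+∣q∣ p q)) (sym (+-suc ∣ p ∣ ∣ q ∣))
∣p∪q∣+∣p∩q∣≡∣p∣+∣q∣ (outside ∷ p) (outside ∷ q) = ∣p∪q∣+∣p∩q∣≡∣p∣+∣q∣ p q

∣p∣≡∣p∩q∣+∣p─q∣ : ∀ (p q : Subset n) → ∣ p ∣ ≡ ∣ p ∩ q ∣ + ∣ p ─ q ∣
∣p∣≡∣p∩q∣+∣p─q∣ []            []            = refl
∣p∣≡∣p∩q∣+∣p─q∣ (inside  ∷ p) (inside  ∷ q) = cong suc (∣p∣≡∣p∩q∣+∣p─q∣ p q)
∣p∣≡∣p∩q∣+∣p─q∣ (inside  ∷ p) (outside ∷ q) = trans (cong suc (∣p∣≡∣p∩q∣+∣p─q∣ p q)) (sym (+-suc ∣ p ∩ q ∣ ∣ p ─ q ∣))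
∣p∣≡∣p∩q∣+∣p─q∣ (outside ∷ p) (inside  ∷ q) = ∣p∣≡∣p∩q∣+∣p─q∣ p q
∣p∣≡∣p∩q∣+∣p─q∣ (outside ∷ p) (outside ∷ q) = ∣p∣≡∣p∩q∣+∣p─q∣ p q

∣p∪q∣≡∣p∣+∣q─p∣ : ∀ (p q : Subset n) → ∣ p ∪ q ∣ ≡ ∣ p ∣ + ∣ q ─ p ∣
∣p∪q∣≡∣p∣+∣q─p∣ []            []            = refl
∣p∪q∣≡∣p∣+∣q─p∣ (inside  ∷ p) (inside  ∷ q) = cong suc (∣p∪q∣≡∣p∣+∣q─p∣ p q)
∣p∪q∣≡∣p∣+∣q─p∣ (inside  ∷ p) (outside ∷ q) = cong suc (∣p∪q∣≡∣p∣+∣q─p∣ p q)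
∣p∪q∣≡∣p∣+∣q─p∣ (outside ∷ p) (inside  ∷ q) = trans (cong suc (∣p∪q∣≡∣p∣+∣q─p∣ p q)) (sym (+-suc ∣ p ∣ ∣ q ─ p ∣))
∣p∪q∣≡∣p∣+∣q─p∣ (outside ∷ p) (outside ∷ q) = ∣p∪q∣≡∣p∣+∣q─p∣ p q

Empty⇒∣p∣≡0 : Empty p → ∣ p ∣ ≡ 0
Empty⇒∣p∣≡0 {n} e = trans (cong ∣_∣ (Empty-unique e)) (∣⊥∣≡0 n)

x∈p⇒⁅x⁆⊆p : x ∈ p → ⁅ x ⁆ ⊆ p
x∈p⇒⁅x⁆⊆p {x = x} {p} x∈p y∈⁅x⁆ = subst (_∈ p) (sym (x∈⁅y⁆⇒x≡y x y∈⁅x⁆)) x∈p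

Nonempty⇒0<∣p∣ : Nonempty p → 0 < ∣ p ∣
Nonempty⇒0<∣p∣ {p = p} (x , x∈p) = subst (_≤ ∣ p ∣) (∣⁅x⁆∣≡1 x) (p⊆q⇒∣p∣≤∣q∣ (x∈p⇒⁅x⁆⊆p x∈p))

0<∣p∣⇒Nonempty : 0 < ∣ p ∣ → Nonempty p
0<∣p∣⇒Nonempty {p = p} 0<∣p∣ with nonempty? p
... | yes ne = ne
... | no  e  = contradiction (Empty⇒∣p∣≡0 e) (>⇒≢ 0<∣p∣)

∣p∪q∣≡∣p∣+∣q∣ : Empty (p ∩ q) → ∣ p ∪ q ∣ ≡ ∣ p ∣ + ∣ q ∣
∣p∪q∣≡∣p∣+∣q∣ {p = p} {q} e = begin
  ∣ p ∪ q ∣                ≡⟨ +-identityʳ _ ⟨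
  ∣ p ∪ q ∣ + 0            ≡⟨ cong (∣ p ∪ q ∣ +_) (Empty⇒∣p∣≡0 e) ⟨
  ∣ p ∪ q ∣ + ∣ p ∩ q ∣    ≡⟨ ∣p∪q∣+∣p∩q∣≡∣p∣+∣q∣ p q ⟩
  ∣ p ∣ + ∣ q ∣            ∎
  where open ≡-Reasoning

∣p∪q∣≤∣p∣+∣q∣ : ∀ (p q : Subset n) → ∣ p ∪ q ∣ ≤ ∣ p ∣ + ∣ q ∣
∣p∪q∣≤∣p∣+∣q∣ p q = ≤-trans (m≤m+n _ _) (≤-reflexive (∣p∪q∣+∣p∩q∣≡∣p∣+∣q∣ p q))

q⊆p⇒∣p∣≡∣q∣+∣p─q∣ : q ⊆ p → ∣ p ∣ ≡ ∣ q ∣ + ∣ p ─ q ∣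
q⊆p⇒∣p∣≡∣q∣+∣p─q∣ {q = q} {p} q⊆p =
  trans (∣p∣≡∣p∩q∣+∣p─q∣ p q) (cong (_+ ∣ p ─ q ∣) (cong ∣_∣ (⊆-antisym (p∩q⊆q p q) λ x∈q → x∈p∩q⁺ (q⊆p x∈q , x∈q))))

∣p∣≤1+∣p-x∣ : ∀ (p : Subset n) x → ∣ p ∣ ≤ suc ∣ p - x ∣
∣p∣≤1+∣p-x∣ p x = ≤-trans (≤-reflexive (∣p∣≡∣p∩q∣+∣p─q∣ p ⁅ x ⁆))
  (+-monoˡ-≤ _ (≤-trans (∣p∩q∣≤∣q∣ p ⁅ x ⁆) (≤-reflexive (∣⁅x⁆∣≡1 x))))

∪-least : p ⊆ r → q ⊆ r → p ∪ q ⊆ r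
∪-least {p = p} {q = q} p⊆r q⊆r x∈ with x∈p∪q⁻ p q x∈
... | inj₁ x∈p = p⊆r x∈p
... | inj₂ x∈q = q⊆r x∈q

∩-mono : ∀ {p′ q′ : Subset n} → p ⊆ p′ → q ⊆ q′ → p ∩ q ⊆ p′ ∩ q′
∩-mono {p = p} {q = q} p⊆p′ q⊆q′ x∈ = x∈p∩q⁺ (p⊆p′ (p∩q⊆p p q x∈) , q⊆q′ (p∩q⊆q p q x∈))

p⊆q∪r⇒∣p∣≤∣p∩q∣+∣p∩r∣ : p ⊆ q ∪ r → ∣ p ∣ ≤ ∣ p ∩ q ∣ + ∣ p ∩ r ∣
p⊆q∪r⇒∣p∣≤∣p∩q∣+∣p∩r∣ {p = p} {q} {r} p⊆q∪r =
  ≤-trans (p⊆q⇒∣p∣≤∣q∣ split) (∣p∪q∣≤∣p∣+∣q∣ (p ∩ q) (p ∩ r))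
  where
  split : p ⊆ (p ∩ q) ∪ (p ∩ r)
  split x∈p with x∈p∪q⁻ q r (p⊆q∪r x∈p)
  ... | inj₁ x∈q = p⊆p∪q (p ∩ r) (x∈p∩q⁺ (x∈p , x∈q))
  ... | inj₂ x∈r = q⊆p∪q (p ∩ q) (p ∩ r) (x∈p∩q⁺ (x∈p , x∈r))

x∈⋃⁻ : ∀ (ps : List (Subset n)) → x ∈ ⋃ ps → ∃ λ p → p ∈ₗ ps × x ∈ p
x∈⋃⁻ []       x∈⋃ = contradiction x∈⋃ ∉⊥
x∈⋃⁻ (p ∷ ps) x∈⋃ with x∈p∪q⁻ p (⋃ ps) x∈⋃
... | inj₁ x∈p  = p , Any.here refl , x∈p
... | inj₂ x∈⋃ps with x∈⋃⁻ ps x∈⋃ps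
...   | q , q∈ps , x∈q = q , Any.there q∈ps , x∈q

x∈⋃⁺ : ∀ {ps : List (Subset n)} → p ∈ₗ ps → x ∈ p → x ∈ ⋃ ps
x∈⋃⁺ {ps = p ∷ ps} (Any.here refl) x∈p = p⊆p∪q (⋃ ps) x∈p
x∈⋃⁺ {ps = q ∷ ps} (Any.there p∈ps) x∈p = q⊆p∪q q (⋃ ps) (x∈⋃⁺ p∈ps x∈p)

module _ {m : ℕ} where

  -- Agrees definitionally with edgeUnion H D when A is the edge family of H.
  ⋃[_]_ : (Fin m → Subset n) → Subset m → Subset n
  ⋃[ A ] D = ⋃ (map (λ i → if lookup D i then A i else ⊥) (allFin m))

  module _ {A : Fin m → Subset n} {D : Subset m} where

    private
      selected : Fin m → Subset n
      selected i = if lookup D i then A i else ⊥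

    x∈⋃[A]D⁻ : x ∈ ⋃[ A ] D → ∃ λ i → i ∈ D × x ∈ A i
    x∈⋃[A]D⁻ x∈⋃ with x∈⋃⁻ (map selected (allFin m)) x∈⋃
    ... | _ , p∈ , x∈p with ∈-map⁻ selected p∈
    ...   | i , _ , refl with lookup D i in eq
    ...     | true  = i , lookup⇒[]= i D eq , x∈p
    ...     | false = contradiction x∈p ∉⊥

    x∈⋃[A]D⁺ : ∀ {i} → i ∈ D → x ∈ A i → x ∈ ⋃[ A ] D
    x∈⋃[A]D⁺ {i = i} i∈D x∈Ai =
      x∈⋃⁺ (∈-map⁺ selected (∈-allFin i)) (subst (λ b → _ ∈ (if b then A i else ⊥)) (sym ([]=⇒lookup i∈D)) x∈Ai)

    ⋃[A]-least : ∀ {W} → (∀ {i} → i ∈ D → A i ⊆ W) → ⋃[ A ] D ⊆ W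
    ⋃[A]-least Ai⊆W x∈⋃ with x∈⋃[A]D⁻ x∈⋃
    ... | i , i∈D , x∈Ai = Ai⊆W i∈D x∈Ai

  ⋃[A]-mono : ∀ {A : Fin m → Subset n} {D D′} → D ⊆ D′ → ⋃[ A ] D ⊆ ⋃[ A ] D′
  ⋃[A]-mono D⊆D′ = ⋃[A]-least λ i∈D x∈Ai → x∈⋃[A]D⁺ (D⊆D′ i∈D) x∈Ai

-- Hall's theorem

module _ {n m : ℕ} (A : Fin m → Subset n) where

  neighbours : Subset n → Subset m
  neighbours Z = tabulate λ i → does (nonempty? (A i ∩ Z))

  module _ {Z : Subset n} {i : Fin m} where

    i∈neighbours⁺ : x ∈ A i → x ∈ Z → i ∈ neighbours Z
    i∈neighbours⁺ x∈Ai x∈Z =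
      lookup⇒[]= i _ (trans (lookup∘tabulate _ i) (dec-true (nonempty? (A i ∩ Z)) (_ , x∈p∩q⁺ (x∈Ai , x∈Z))))

    i∈neighbours⁻ : i ∈ neighbours Z → Nonempty (A i ∩ Z)
    i∈neighbours⁻ i∈N with nonempty? (A i ∩ Z) | trans (sym (lookup∘tabulate (λ j → does (nonempty? (A j ∩ Z))) i)) ([]=⇒lookup i∈N)
    ... | yes ne | _  = ne
    ... | no  _  | ()

  HallCondition : Subset n → Subset m → Set
  HallCondition U F = ∀ Z → Z ⊆ U → ∣ Z ∣ ≤ ∣ F ∩ neighbours Z ∣

  -- By Hall's theorem this says that S can be matched bijectively onto U;
  -- only this counting form is needed.
  PerfectlyMatchable : Subset n → Subset m → Set
  PerfectlyMatchable U S = ∣ S ∣ ≡ ∣ U ∣ × (∀ D → D ⊆ S → ∣ D ∣ ≤ ∣ ⋃[ A ] D ∩ U ∣)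

  Critical : Subset n → Subset m → Subset n → Set
  Critical U F Z = Z ⊆ U × Nonempty Z × ∣ Z ∣ < ∣ U ∣ × ∣ F ∩ neighbours Z ∣ ≤ ∣ Z ∣

  critical? : ∀ U F Z → Dec (Critical U F Z)
  critical? U F Z = Z ⊆? U ×-dec nonempty? Z ×-dec ∣ Z ∣ <? ∣ U ∣ ×-dec ∣ F ∩ neighbours Z ∣ ≤? ∣ Z ∣

  neighbours-mono : ∀ {W Z} → W ⊆ Z → neighbours W ⊆ neighbours Z
  neighbours-mono W⊆Z i∈N with i∈neighbours⁻ i∈N
  ... | _ , x∈Ai∩W = i∈neighbours⁺ (p∩q⊆p _ _ x∈Ai∩W) (W⊆Z (p∩q⊆q _ _ x∈Ai∩W))

  neighbours-∪ : ∀ {W Z i} → i ∈ neighbours (W ∪ Z) → i ∈ neighbours W ⊎ i ∈ neighbours Z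
  neighbours-∪ {W} {Z} i∈N with i∈neighbours⁻ i∈N
  ... | _ , x∈Ai∩W∪Z with x∈p∩q⁻ _ _ x∈Ai∩W∪Z
  ...   | x∈Ai , x∈W∪Z with x∈p∪q⁻ W Z x∈W∪Z
  ...     | inj₁ x∈W = inj₁ (i∈neighbours⁺ x∈Ai x∈W)
  ...     | inj₂ x∈Z = inj₂ (i∈neighbours⁺ x∈Ai x∈Z)

  PerfectlyMatchable-∪ : ∀ {U Z S₁ S₂} → Z ⊆ U → Empty (S₁ ∩ S₂) →
    PerfectlyMatchable Z S₁ → PerfectlyMatchable (U ─ Z) S₂ → PerfectlyMatchable U (S₁ ∪ S₂)
  PerfectlyMatchable-∪ {U} {Z} {S₁} {S₂} Z⊆U S₁∩S₂-empty (∣S₁∣≡∣Z∣ , match₁) (∣S₂∣≡∣U─Z∣ , match₂) =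
    size , match
    where
    size : ∣ S₁ ∪ S₂ ∣ ≡ ∣ U ∣
    size = begin
      ∣ S₁ ∪ S₂ ∣        ≡⟨ ∣p∪q∣≡∣p∣+∣q∣ S₁∩S₂-empty ⟩
      ∣ S₁ ∣ + ∣ S₂ ∣    ≡⟨ cong₂ _+_ ∣S₁∣≡∣Z∣ ∣S₂∣≡∣U─Z∣ ⟩
      ∣ Z ∣ + ∣ U ─ Z ∣  ≡⟨ q⊆p⇒∣p∣≡∣q∣+∣p─q∣ Z⊆U ⟨
      ∣ U ∣              ∎
      where open ≡-Reasoning

    match : ∀ D → D ⊆ S₁ ∪ S₂ → ∣ D ∣ ≤ ∣ ⋃[ A ] D ∩ U ∣
    match D D⊆S₁∪S₂ = begin
      ∣ D ∣                                  ≤⟨ p⊆q∪r⇒∣p∣≤∣p∩q∣+∣p∩r∣ D⊆S₁∪S₂ ⟩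
      ∣ D ∩ S₁ ∣ + ∣ D ∩ S₂ ∣                ≤⟨ +-mono-≤ (match₁ (D ∩ S₁) (p∩q⊆q D S₁)) (match₂ (D ∩ S₂) (p∩q⊆q D S₂)) ⟩
      ∣ image₁ ∣ + ∣ image₂ ∣                ≡⟨ ∣p∪q∣≡∣p∣+∣q∣ images-disjoint ⟨
      ∣ image₁ ∪ image₂ ∣                    ≤⟨ p⊆q⇒∣p∣≤∣q∣ images⊆ ⟩
      ∣ ⋃[ A ] D ∩ U ∣                       ∎
      where
      open ≤-Reasoning
      image₁ = ⋃[ A ] (D ∩ S₁) ∩ Z
      image₂ = ⋃[ A ] (D ∩ S₂) ∩ (U ─ Z)

      images-disjoint : Empty (image₁ ∩ image₂)
      images-disjoint (_ , x∈) with x∈p∩q⁻ image₁ image₂ x∈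
      ... | x∈image₁ , x∈image₂ = x∈p─q⇒x∉q (p∩q⊆q _ _ x∈image₂) (p∩q⊆q _ _ x∈image₁)

      images⊆ : image₁ ∪ image₂ ⊆ ⋃[ A ] D ∩ U
      images⊆ = ∪-least (∩-mono (⋃[A]-mono (p∩q⊆p D S₁)) Z⊆U) (∩-mono (⋃[A]-mono (p∩q⊆p D S₂)) (p─q⊆p U Z))

  PerfectlyMatchable-⊥ : ∀ {U} → Empty U → PerfectlyMatchable U ⊥
  PerfectlyMatchable-⊥ U-empty =
    trans (∣⊥∣≡0 m) (sym (Empty⇒∣p∣≡0 U-empty)) ,
    λ D D⊆⊥ → ≤-trans (p⊆q⇒∣p∣≤∣q∣ D⊆⊥) (≤-trans (≤-reflexive (∣⊥∣≡0 m)) z≤n)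

  PerfectlyMatchable-⁅⁆ : ∀ {v e} → v ∈ A e → PerfectlyMatchable ⁅ v ⁆ ⁅ e ⁆
  PerfectlyMatchable-⁅⁆ {v} {e} v∈Ae = trans (∣⁅x⁆∣≡1 e) (sym (∣⁅x⁆∣≡1 v)) , match
    where
    match : ∀ D → D ⊆ ⁅ e ⁆ → ∣ D ∣ ≤ ∣ ⋃[ A ] D ∩ ⁅ v ⁆ ∣
    match D D⊆⁅e⁆ with e ∈? D
    ... | yes e∈D = ≤-trans (p⊆q⇒∣p∣≤∣q∣ D⊆⁅e⁆) (subst (_≤ _) (sym (∣⁅x⁆∣≡1 e))
                      (Nonempty⇒0<∣p∣ (v , x∈p∩q⁺ (x∈⋃[A]D⁺ e∈D v∈Ae , x∈⁅x⁆ v))))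
    ... | no  e∉D = ≤-trans (≤-reflexive (Empty⇒∣p∣≡0 D-empty)) z≤n
      where
      D-empty : Empty D
      D-empty (i , i∈D) = e∉D (subst (_∈ D) (x∈⁅y⁆⇒x≡y e (D⊆⁅e⁆ i∈D)) i∈D)

  HallCondition-restrict : ∀ {U F Z} → Z ⊆ U → HallCondition U F → HallCondition Z (F ∩ neighbours Z)
  HallCondition-restrict {F = F} {Z} Z⊆U hall W W⊆Z =
    ≤-trans (hall W (⊆-trans W⊆Z Z⊆U)) (p⊆q⇒∣p∣≤∣q∣ restrict)
    where
    restrict : F ∩ neighbours W ⊆ (F ∩ neighbours Z) ∩ neighbours W
    restrict i∈ with x∈p∩q⁻ F _ i∈
    ... | i∈F , i∈NW = x∈p∩q⁺ (x∈p∩q⁺ (i∈F , neighbours-mono W⊆Z i∈NW) , i∈NW)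

  HallCondition-contract : ∀ {U F Z} → Z ⊆ U → ∣ F ∩ neighbours Z ∣ ≤ ∣ Z ∣ →
    HallCondition U F → HallCondition (U ─ Z) (F ─ neighbours Z)
  HallCondition-contract {U} {F} {Z} Z⊆U critical hall W W⊆U─Z = +-cancelʳ-≤ ∣ Z ∣ _ _ (begin
    ∣ W ∣ + ∣ Z ∣                             ≡⟨ ∣p∪q∣≡∣p∣+∣q∣ W∩Z-empty ⟨
    ∣ W ∪ Z ∣                                 ≤⟨ hall (W ∪ Z) W∪Z⊆U ⟩
    ∣ F ∩ neighbours (W ∪ Z) ∣                ≤⟨ p⊆q⇒∣p∣≤∣q∣ split ⟩
    ∣ outer ∪ (F ∩ neighbours Z) ∣            ≤⟨ ∣p∪q∣≤∣p∣+∣q∣ outer _ ⟩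
    ∣ outer ∣ + ∣ F ∩ neighbours Z ∣          ≤⟨ +-monoʳ-≤ ∣ outer ∣ critical ⟩
    ∣ outer ∣ + ∣ Z ∣                         ∎)
    where
    open ≤-Reasoning
    outer = (F ─ neighbours Z) ∩ neighbours W

    W∩Z-empty : Empty (W ∩ Z)
    W∩Z-empty (_ , x∈) with x∈p∩q⁻ W Z x∈
    ... | x∈W , x∈Z = x∈p─q⇒x∉q (W⊆U─Z x∈W) x∈Z

    W∪Z⊆U : W ∪ Z ⊆ U
    W∪Z⊆U x∈ with x∈p∪q⁻ W Z x∈
    ... | inj₁ x∈W = p─q⊆p U Z (W⊆U─Z x∈W)
    ... | inj₂ x∈Z = Z⊆U x∈Z

    split : F ∩ neighbours (W ∪ Z) ⊆ outer ∪ (F ∩ neighbours Z)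
    split {i} i∈ with x∈p∩q⁻ F _ i∈
    ... | i∈F , i∈N with i ∈? neighbours Z
    ...   | yes i∈NZ = q⊆p∪q outer _ (x∈p∩q⁺ (i∈F , i∈NZ))
    ...   | no  i∉NZ with neighbours-∪ i∈N
    ...     | inj₁ i∈NW = p⊆p∪q _ (x∈p∩q⁺ (x∈p∧x∉q⇒x∈p─q i∈F i∉NZ , i∈NW))
    ...     | inj₂ i∈NZ = contradiction i∈NZ i∉NZ

  HallCondition-delete : ∀ {U F v} e → ¬ ∃ (Critical U F) → v ∈ U →
    HallCondition (U - v) (F - e)
  HallCondition-delete {U} {F} {v} e no-critical v∈U W W⊆U-v with nonempty? W
  ... | no  W-empty    = ≤-trans (≤-reflexive (Empty⇒∣p∣≡0 W-empty)) z≤n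
  ... | yes W-nonempty = ≤-pred (begin-strict
    ∣ W ∣                       <⟨ ≰⇒> W-not-critical ⟩
    ∣ F ∩ neighbours W ∣        ≤⟨ p⊆q⇒∣p∣≤∣q∣ split ⟩
    ∣ rest ∪ ⁅ e ⁆ ∣            ≤⟨ ∣p∪q∣≤∣p∣+∣q∣ rest ⁅ e ⁆ ⟩
    ∣ rest ∣ + ∣ ⁅ e ⁆ ∣        ≡⟨ cong (∣ rest ∣ +_) (∣⁅x⁆∣≡1 e) ⟩
    ∣ rest ∣ + 1                ≡⟨ +-comm ∣ rest ∣ 1 ⟩
    suc ∣ rest ∣                ∎)
    where
    open ≤-Reasoning
    rest = (F - e) ∩ neighbours W

    W⊆U : W ⊆ U
    W⊆U = ⊆-trans W⊆U-v (p─q⊆p U ⁅ v ⁆)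

    ∣W∣<∣U∣ : ∣ W ∣ < ∣ U ∣
    ∣W∣<∣U∣ = ≤-<-trans (p⊆q⇒∣p∣≤∣q∣ W⊆U-v) (x∈p⇒∣p-x∣<∣p∣ v∈U)

    W-not-critical : ¬ ∣ F ∩ neighbours W ∣ ≤ ∣ W ∣
    W-not-critical ∣N∣≤∣W∣ = no-critical (W , W⊆U , W-nonempty , ∣W∣<∣U∣ , ∣N∣≤∣W∣)

    split : F ∩ neighbours W ⊆ rest ∪ ⁅ e ⁆
    split {i} i∈ with x∈p∩q⁻ F _ i∈ | i ≟ e
    ... | _         | yes refl = q⊆p∪q rest ⁅ e ⁆ (x∈⁅x⁆ e)
    ... | i∈F , i∈N | no  i≢e  = p⊆p∪q ⁅ e ⁆ (x∈p∩q⁺ (x∈p∧x≢y⇒x∈p-y i∈F i≢e , i∈N))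

  HallCondition⇒neighbour : ∀ {U F v} → HallCondition U F → v ∈ U → ∃ λ e → e ∈ F × v ∈ A e
  HallCondition⇒neighbour {U} {F} {v} hall v∈U = e , e∈F , subst (_∈ A e) (x∈⁅y⁆⇒x≡y v y∈⁅v⁆) y∈Ae
    where
    0<∣F∩N⁅v⁆∣ : 0 < ∣ F ∩ neighbours ⁅ v ⁆ ∣
    0<∣F∩N⁅v⁆∣ = subst (_≤ ∣ F ∩ neighbours ⁅ v ⁆ ∣) (∣⁅x⁆∣≡1 v) (hall ⁅ v ⁆ (x∈p⇒⁅x⁆⊆p v∈U))

    e = proj₁ (0<∣p∣⇒Nonempty 0<∣F∩N⁅v⁆∣)
    e∈F∩N = proj₂ (0<∣p∣⇒Nonempty 0<∣F∩N⁅v⁆∣)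
    e∈F = p∩q⊆p F _ e∈F∩N
    y∈Ae∩⁅v⁆ = proj₂ (i∈neighbours⁻ (p∩q⊆q F _ e∈F∩N))
    y∈Ae = p∩q⊆p (A e) ⁅ v ⁆ y∈Ae∩⁅v⁆
    y∈⁅v⁆ = p∩q⊆q (A e) ⁅ v ⁆ y∈Ae∩⁅v⁆

  -- Halmos–Vaughan: split U at a critical set if there is one; otherwise match
  -- any v ∈ U to a neighbouring edge and delete both.
  hall-acc : ∀ {U F} → Acc _<_ ∣ U ∣ → HallCondition U F → ∃ λ S → S ⊆ F × PerfectlyMatchable U S
  hall-acc {U} {F} (acc smaller) hall with nonempty? U
  ... | no U-empty = ⊥ , ⊥⊆ , PerfectlyMatchable-⊥ U-empty
  ... | yes (v , v∈U) with anySubset? (critical? U F)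
  ...   | yes (Z , Z⊆U , (z , z∈Z) , ∣Z∣<∣U∣ , ∣N∣≤∣Z∣)
    with hall-acc {Z} {F ∩ neighbours Z} (smaller ∣Z∣<∣U∣) (HallCondition-restrict {U} {F} Z⊆U hall)
       | hall-acc {U ─ Z} {F ─ neighbours Z} (smaller (p∩q≢∅⇒∣p─q∣<∣p∣ U Z (z , x∈p∩q⁺ (Z⊆U z∈Z , z∈Z))))
           (HallCondition-contract {U} {F} Z⊆U ∣N∣≤∣Z∣ hall)
  ...     | S₁ , S₁⊆ , matched₁ | S₂ , S₂⊆ , matched₂ =
    S₁ ∪ S₂ , ∪-least (⊆-trans S₁⊆ (p∩q⊆p F _)) (⊆-trans S₂⊆ (p─q⊆p F _)) ,
    PerfectlyMatchable-∪ Z⊆U S₁∩S₂-empty matched₁ matched₂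
    where
    S₁∩S₂-empty : Empty (S₁ ∩ S₂)
    S₁∩S₂-empty (_ , i∈) with x∈p∩q⁻ S₁ S₂ i∈
    ... | i∈S₁ , i∈S₂ = x∈p─q⇒x∉q (S₂⊆ i∈S₂) (p∩q⊆q F _ (S₁⊆ i∈S₁))
  hall-acc {U} {F} (acc smaller) hall | yes (v , v∈U) | no no-critical
    with HallCondition⇒neighbour hall v∈U
  ... | e , e∈F , v∈Ae
    with hall-acc {U - v} {F - e} (smaller (x∈p⇒∣p-x∣<∣p∣ v∈U)) (HallCondition-delete {U} {F} e no-critical v∈U)
  ... | S , S⊆F-e , matched =
    ⁅ e ⁆ ∪ S , ∪-least (x∈p⇒⁅x⁆⊆p e∈F) (⊆-trans S⊆F-e (p─q⊆p F _)) ,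
    PerfectlyMatchable-∪ (x∈p⇒⁅x⁆⊆p v∈U) ⁅e⁆∩S-empty (PerfectlyMatchable-⁅⁆ v∈Ae) matched
    where
    ⁅e⁆∩S-empty : Empty (⁅ e ⁆ ∩ S)
    ⁅e⁆∩S-empty (_ , i∈) with x∈p∩q⁻ ⁅ e ⁆ S i∈
    ... | i∈⁅e⁆ , i∈S = x∈p─q⇒x∉q (S⊆F-e i∈S) i∈⁅e⁆

  hall : ∀ {U F} → HallCondition U F → ∃ λ S → S ⊆ F × PerfectlyMatchable U S
  hall {U} = hall-acc (<-wellFounded ∣ U ∣)

-- Spanning forests as expanding edge sets

module _ {n : ℕ} (H : Hypergraph n) where
  open Hypergraph H

  Expanding : EdgeSet H → Set
  Expanding F = ∀ D → D ⊆ F → Nonempty D → ∣ D ∣ < ∣ edgeUnion H D ∣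

  contracting⇒cycle : ∀ {D} → Acc _<_ ∣ D ∣ → Nonempty D → ∣ edgeUnion H D ∣ ≤ ∣ D ∣ →
    ∃ λ C → C ⊆ D × IsCycle H C
  contracting⇒cycle {D} (acc smaller) D-nonempty contracting
    with anySubset? (λ D′ → D′ ⊂? D ×-dec nonempty? D′ ×-dec ∣ edgeUnion H D′ ∣ ≤? ∣ D′ ∣)
  ... | yes (D′ , D′⊂D , D′-nonempty , D′-contracting)
    with contracting⇒cycle (smaller (p⊂q⇒∣p∣<∣q∣ D′⊂D)) D′-nonempty D′-contracting
  ...   | C , C⊆D′ , cycle = C , ⊆-trans C⊆D′ (p⊂q⇒p⊆q D′⊂D) , cycle
  contracting⇒cycle {D} (acc smaller) D-nonempty@(x , x∈D) contracting | no minimal =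
    D , ⊆-refl , D-nonempty , ≤-antisym ∣D∣≤∣⋃D∣ contracting , no-balanced-proper-subset
    where
    no-balanced-proper-subset : ∀ D′ → D′ ⊂ D → Nonempty D′ → ¬ Balanced H D′
    no-balanced-proper-subset D′ D′⊂D D′-nonempty balanced = minimal (D′ , D′⊂D , D′-nonempty , ≤-reflexive (sym balanced))

    ∣D-x∣<∣⋃D∣ : ∣ D - x ∣ < ∣ edgeUnion H D ∣
    ∣D-x∣<∣⋃D∣ with nonempty? (D - x)
    ... | yes D-x-nonempty = ≤-trans
      (≰⇒> λ D-x-contracting → minimal (D - x , x∈p⇒p-x⊂p x∈D , D-x-nonempty , D-x-contracting))
      (p⊆q⇒∣p∣≤∣q∣ (⋃[A]-mono (p─q⊆p D ⁅ x ⁆)))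
    ... | no D-x-empty = subst (_< ∣ edgeUnion H D ∣) (sym (Empty⇒∣p∣≡0 D-x-empty))
      (Nonempty⇒0<∣p∣ (proj₁ (nonempty x) , x∈⋃[A]D⁺ x∈D (proj₂ (nonempty x))))

    ∣D∣≤∣⋃D∣ : ∣ D ∣ ≤ ∣ edgeUnion H D ∣
    ∣D∣≤∣⋃D∣ = ≤-trans (∣p∣≤1+∣p-x∣ D x) ∣D-x∣<∣⋃D∣

  forest⇒expanding : ∀ {F} → IsSpanningForest H F → Expanding F
  forest⇒expanding forest D D⊆F D-nonempty with ∣ D ∣ <? ∣ edgeUnion H D ∣
  ... | yes expanding = expanding
  ... | no  ¬expanding with contracting⇒cycle (<-wellFounded ∣ D ∣) D-nonempty (≮⇒≥ ¬expanding)
  ...   | C , C⊆D , cycle = contradiction cycle (forest C (⊆-trans C⊆D D⊆F))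

  expanding⇒forest : ∀ {F} → Expanding F → IsSpanningForest H F
  expanding⇒forest expanding C C⊆F (C-nonempty , balanced , _) = <-irrefl balanced (expanding C C⊆F C-nonempty)

  spanningTree⇒HallCondition : ∀ {W F U} → IsSpanningTreeOn H W F → U ⊆ W → Nonempty (W ─ U) →
    HallCondition edge U F
  spanningTree⇒HallCondition {W} {F} {U} (F-induced , forest , ∣F∣+1≡∣W∣) U⊆W (w , w∈W─U) Z Z⊆U =
    +-cancelʳ-≤ (suc ∣ D ∣) ∣ Z ∣ _ (begin
      ∣ Z ∣ + suc ∣ D ∣                        ≤⟨ +-monoʳ-≤ ∣ Z ∣ room-outside-Z ⟩
      ∣ Z ∣ + ∣ W ─ Z ∣                        ≡⟨ q⊆p⇒∣p∣≡∣q∣+∣p─q∣ (⊆-trans Z⊆U U⊆W) ⟨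
      ∣ W ∣                                    ≡⟨ ∣F∣+1≡∣W∣ ⟨
      ∣ F ∣ + 1                                ≡⟨ cong (_+ 1) (∣p∣≡∣p∩q∣+∣p─q∣ F (neighbours edge Z)) ⟩
      ∣ F ∩ neighbours edge Z ∣ + ∣ D ∣ + 1    ≡⟨ +-assoc _ ∣ D ∣ 1 ⟩
      ∣ F ∩ neighbours edge Z ∣ + (∣ D ∣ + 1)  ≡⟨ cong (∣ F ∩ neighbours edge Z ∣ +_) (+-comm ∣ D ∣ 1) ⟩
      ∣ F ∩ neighbours edge Z ∣ + suc ∣ D ∣    ∎)
    where
    open ≤-Reasoning
    D = F ─ neighbours edge Z

    ⋃D⊆W─Z : edgeUnion H D ⊆ W ─ Z
    ⋃D⊆W─Z = ⋃[A]-least {D = D} λ {i} i∈D {x} x∈edge → x∈p∧x∉q⇒x∈p─q (F-induced (p─q⊆p F _ i∈D) x∈edge)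
      λ x∈Z → x∈p─q⇒x∉q i∈D (i∈neighbours⁺ edge x∈edge x∈Z)

    room-outside-Z : suc ∣ D ∣ ≤ ∣ W ─ Z ∣
    room-outside-Z with nonempty? D
    ... | yes D-nonempty = ≤-trans (forest⇒expanding forest D (p─q⊆p F _) D-nonempty) (p⊆q⇒∣p∣≤∣q∣ ⋃D⊆W─Z)
    ... | no  D-empty    = subst (_≤ ∣ W ─ Z ∣) (cong suc (sym (Empty⇒∣p∣≡0 D-empty)))
      (Nonempty⇒0<∣p∣ (w , x∈p∧x∉q⇒x∈p─q (p─q⊆p W U w∈W─U) λ w∈Z → x∈p─q⇒x∉q w∈W─U (Z⊆U w∈Z)))

  matched-disjoint : ∀ {W U F S} → InInduced H W F → Empty (W ∩ U) → PerfectlyMatchable edge U S → Empty (F ∩ S)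
  matched-disjoint {W} {U} {F} {S} F-induced W∩U-empty (_ , match) (i , i∈F∩S)
    with 0<∣p∣⇒Nonempty (subst (_≤ ∣ edgeUnion H ⁅ i ⁆ ∩ U ∣) (∣⁅x⁆∣≡1 i)
           (match ⁅ i ⁆ (x∈p⇒⁅x⁆⊆p (p∩q⊆q F S i∈F∩S))))
  ... | x , x∈⋃⁅i⁆∩U = W∩U-empty (x , ∩-mono ⋃⁅i⁆⊆W ⊆-refl x∈⋃⁅i⁆∩U)
    where
    ⋃⁅i⁆⊆W : edgeUnion H ⁅ i ⁆ ⊆ W
    ⋃⁅i⁆⊆W = ⋃[A]-least λ j∈⁅i⁆ → F-induced (x∈p⇒⁅x⁆⊆p (p∩q⊆p F S i∈F∩S) j∈⁅i⁆)

  expanding-∪ : ∀ {W U F₁ F₂ S} → InInduced H W F₁ → Empty (W ∩ U) → Expanding F₁ → Expanding F₂ →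
    S ⊆ F₂ → PerfectlyMatchable edge U S → Expanding (F₁ ∪ S)
  expanding-∪ {W} {U} {F₁} {F₂} {S} F₁-induced W∩U-empty expanding₁ expanding₂ S⊆F₂ (_ , match) D D⊆F₁∪S D-nonempty
    with nonempty? (D ∩ F₁)
  ... | no D∩F₁-empty = expanding₂ D (⊆-trans D⊆S S⊆F₂) D-nonempty
    where
    D⊆S : D ⊆ S
    D⊆S i∈D with x∈p∪q⁻ F₁ S (D⊆F₁∪S i∈D)
    ... | inj₁ i∈F₁ = contradiction (_ , x∈p∩q⁺ (i∈D , i∈F₁)) D∩F₁-empty
    ... | inj₂ i∈S  = i∈S
  ... | yes D∩F₁-nonempty = begin-strict
    ∣ D ∣                        ≤⟨ p⊆q∪r⇒∣p∣≤∣p∩q∣+∣p∩r∣ D⊆F₁∪S ⟩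
    ∣ D ∩ F₁ ∣ + ∣ D ∩ S ∣       <⟨ +-mono-<-≤ (expanding₁ (D ∩ F₁) (p∩q⊆q D F₁) D∩F₁-nonempty) (match (D ∩ S) (p∩q⊆q D S)) ⟩
    ∣ inner ∣ + ∣ outer ∣        ≡⟨ ∣p∪q∣≡∣p∣+∣q∣ inner∩outer-empty ⟨
    ∣ inner ∪ outer ∣            ≤⟨ p⊆q⇒∣p∣≤∣q∣ (∪-least (⋃[A]-mono (p∩q⊆p D F₁)) (⊆-trans (p∩q⊆p _ U) (⋃[A]-mono (p∩q⊆p D S)))) ⟩
    ∣ edgeUnion H D ∣            ∎
    where
    open ≤-Reasoning
    inner = edgeUnion H (D ∩ F₁)
    outer = edgeUnion H (D ∩ S) ∩ U

    inner∩outer-empty : Empty (inner ∩ outer)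
    inner∩outer-empty (x , x∈) =
      W∩U-empty (x , ∩-mono (⋃[A]-least λ i∈ → F₁-induced (p∩q⊆q D F₁ i∈)) (p∩q⊆q _ U) x∈)

  spanningTree-∪ : ∀ {V₁ V₂ F₁ F₂ S} → IsSpanningTreeOn H V₁ F₁ → IsSpanningTreeOn H V₂ F₂ →
    S ⊆ F₂ → PerfectlyMatchable edge (V₂ ─ V₁) S → IsSpanningTreeOn H (V₁ ∪ V₂) (F₁ ∪ S)
  spanningTree-∪ {V₁} {V₂} {F₁} {F₂} {S} (F₁-induced , forest₁ , ∣F₁∣+1≡∣V₁∣) (F₂-induced , forest₂ , _) S⊆F₂ matched =
    induced , expanding⇒forest expanding , size
    where
    V₁∩[V₂─V₁]-empty : Empty (V₁ ∩ (V₂ ─ V₁))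
    V₁∩[V₂─V₁]-empty (x , x∈) = x∈p─q⇒x∉q (p∩q⊆q V₁ _ x∈) (p∩q⊆p V₁ _ x∈)

    induced : InInduced H (V₁ ∪ V₂) (F₁ ∪ S)
    induced i∈ with x∈p∪q⁻ F₁ S i∈
    ... | inj₁ i∈F₁ = p⊆p∪q V₂ ∘ F₁-induced i∈F₁
    ... | inj₂ i∈S  = q⊆p∪q V₁ V₂ ∘ F₂-induced (S⊆F₂ i∈S)

    expanding : Expanding (F₁ ∪ S)
    expanding = expanding-∪ F₁-induced V₁∩[V₂─V₁]-empty (forest⇒expanding forest₁) (forest⇒expanding forest₂) S⊆F₂ matched

    size : ∣ F₁ ∪ S ∣ + 1 ≡ ∣ V₁ ∪ V₂ ∣
    size = begin
      ∣ F₁ ∪ S ∣ + 1            ≡⟨ cong (_+ 1) (∣p∪q∣≡∣p∣+∣q∣ (matched-disjoint F₁-induced V₁∩[V₂─V₁]-empty matched)) ⟩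
      ∣ F₁ ∣ + ∣ S ∣ + 1        ≡⟨ xy∙z≈xz∙y ∣ F₁ ∣ ∣ S ∣ 1 ⟩
      ∣ F₁ ∣ + 1 + ∣ S ∣        ≡⟨ cong₂ _+_ ∣F₁∣+1≡∣V₁∣ (proj₁ matched) ⟩
      ∣ V₁ ∣ + ∣ V₂ ─ V₁ ∣      ≡⟨ ∣p∪q∣≡∣p∣+∣q─p∣ V₁ V₂ ⟨
      ∣ V₁ ∪ V₂ ∣               ∎
      where open ≡-Reasoning

mainTheorem12 : ∀ {n : ℕ} (H : Hypergraph n) (V₁ V₂ : Subset n) →
    Nonempty (V₁ ∩ V₂) →
    StronglyConnectedOn H V₁ →
    StronglyConnectedOn H V₂ →
    StronglyConnectedOn H (V₁ ∪ V₂)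
mainTheorem12 H V₁ V₂ (v , v∈V₁∩V₂) (F₁ , tree₁) (F₂ , tree₂)
  with hall (Hypergraph.edge H) (spanningTree⇒HallCondition H tree₂ (p─q⊆p V₂ V₁) (v , v∈V₂─[V₂─V₁]))
  where
  v∈V₂─[V₂─V₁] : v ∈ V₂ ─ (V₂ ─ V₁)
  v∈V₂─[V₂─V₁] = x∈p∧x∉q⇒x∈p─q (p∩q⊆q V₁ V₂ v∈V₁∩V₂) λ v∈V₂─V₁ → x∈p─q⇒x∉q v∈V₂─V₁ (p∩q⊆p V₁ V₂ v∈V₁∩V₂)
... | S , S⊆F₂ , matched = F₁ ∪ S , spanningTree-∪ H tree₁ tree₂ S⊆F₂ matched
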